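{- Let $T$ be a perfect Roman domination stable tree and $u\in W(T)$. If $T'$ is the tree obtained from $T$ by adding a single new vertex $v$ and the edge $uv$, then $\gamma_R^p(T')=\gamma_R^p(T)+1$.
   Context: All graphs are finite and simple. A perfect Roman dominating function (PRDF) on a graph $G=(V,E)$ is a function $f:V\to\{0,1,2\}$ such that every vertex $u$ with $f(u)=0$ is adjacent to exactly one vertex $v$ with $f(v)=2$. Its weight is $w(f)=\sum_{u\in V}f(u)$, and $\gamma_R^p(G)$ is the minimum weight of a PRDF on $G$; a PRDF of weight $\gamma_R^p(G)$ is a $\gamma_R^p$-function of $G$. A graph $G$ is perfect Roman domination stable if $\gamma_R^p(G-v)=\gamma_R^p(G)$ for every vertex $v\in V(G)$. For a tree $T$, $W(T)=\{u\in V(T): f(u)=0 \text{ for every } \gamma_R^p\text{ -function } f \text{ of } T\}$. -}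

module Defs where

open import Data.Nat using (ℕ; zero; suc; _+_; _≤_)
open import Data.Fin using (Fin; zero; suc; punchIn; _≟_)
open import Data.List using (List; []; _∷_; _++_; [_]; map; allFin)
open import Data.Nat.ListAction using (sum)
open import Data.List.Relation.Unary.Linked using (Linked)
open import Data.List.Relation.Unary.Unique.Propositional using (Unique)
open import Data.Bool using (Bool; true; false)
open import Data.Product using (Σ; ∃; _×_)
open import Relation.Nullary using (¬_)
open import Relation.Nullary.Decidable using (⌊_⌋)
open import Relation.Binary.PropositionalEquality using (_≡_)

record Graph (n : ℕ) : Set where
  field
    adj    : Fin n → Fin n → Bool
    sym    : ∀ x y → adj x y ≡ adj y x
    irrefl : ∀ x → adj x x ≡ false
open Graph public

Adj : ∀ {n} → Graph n → Fin n → Fin n → Set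
Adj G x y = adj G x y ≡ true

data Walk {n : ℕ} (G : Graph n) : Fin n → Fin n → Set where
  here : ∀ {x} → Walk G x x
  step : ∀ {x y z} → Adj G x y → Walk G y z → Walk G x z

Connected : ∀ {n} → Graph n → Set
Connected {n} G = ∀ (x y : Fin n) → Walk G x y

HasCycle : ∀ {n} → Graph n → Set
HasCycle {n} G = Σ (Fin n) λ x → Σ (Fin n) λ y → Σ (Fin n) λ z → Σ (List (Fin n)) λ rest →
  Unique (x ∷ y ∷ z ∷ rest) × Linked (Adj G) (x ∷ y ∷ z ∷ rest ++ [ x ])

IsTree : ∀ {n} → Graph n → Set
IsTree {n} G = Σ (Fin n) (λ _ → Connected G) × ¬ HasCycle G

Label : Set
Label = Fin 3

val : Label → ℕ
val zero = 0
val (suc zero) = 1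
val (suc (suc zero)) = 2

two : Label
two = suc (suc zero)

IsPRDF : ∀ {n} → Graph n → (Fin n → Label) → Set
IsPRDF {n} G f = ∀ (u : Fin n) → f u ≡ zero →
  Σ (Fin n) λ v → (Adj G u v × f v ≡ two) ×
    (∀ (w : Fin n) → Adj G u w → f w ≡ two → w ≡ v)

weight : ∀ {n} → (Fin n → Label) → ℕ
weight {n} f = sum (map (λ u → val (f u)) (allFin n))

IsGammaRP : ∀ {n} → Graph n → ℕ → Set
IsGammaRP {n} G k =
  (Σ (Fin n → Label) λ f → IsPRDF G f × weight f ≡ k) ×
  (∀ (f : Fin n → Label) → IsPRDF G f → k ≤ weight f)

IsGammaRPFunction : ∀ {n} → Graph n → (Fin n → Label) → Set
IsGammaRPFunction {n} G f = IsPRDF G f × (∀ (g : Fin n → Label) → IsPRDF G g → weight f ≤ weight g)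

deleteVertex : ∀ {n} → Graph (suc n) → Fin (suc n) → Graph n
deleteVertex G v = record
  { adj = λ x y → adj G (punchIn v x) (punchIn v y)
  ; sym = λ x y → sym G (punchIn v x) (punchIn v y)
  ; irrefl = λ x → irrefl G (punchIn v x) }

PRDStable : ∀ {n} → Graph (suc n) → Set
PRDStable {n} G = ∀ (v : Fin (suc n)) (k k′ : ℕ) →
  IsGammaRP G k → IsGammaRP (deleteVertex G v) k′ → k′ ≡ k

InW : ∀ {n} → Graph n → Fin n → Set
InW {n} G u = ∀ (f : Fin n → Label) → IsGammaRPFunction G f → f u ≡ zero

-- Add a new vertex (zero) adjacent only to u; old vertex i becomes suc i.
pendAdj : ∀ {n} → Graph n → Fin n → Fin (suc n) → Fin (suc n) → Bool
pendAdj G u zero zero = false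
pendAdj G u zero (suc j) = ⌊ j ≟ u ⌋
pendAdj G u (suc i) zero = ⌊ i ≟ u ⌋
pendAdj G u (suc i) (suc j) = adj G i j

pendSym : ∀ {n} (G : Graph n) (u : Fin n) x y → pendAdj G u x y ≡ pendAdj G u y x
pendSym G u zero zero = Relation.Binary.PropositionalEquality.refl
pendSym G u zero (suc j) = Relation.Binary.PropositionalEquality.refl
pendSym G u (suc i) zero = Relation.Binary.PropositionalEquality.refl
pendSym G u (suc i) (suc j) = sym G i j

pendIrr : ∀ {n} (G : Graph n) (u : Fin n) x → pendAdj G u x x ≡ false
pendIrr G u zero = Relation.Binary.PropositionalEquality.refl
pendIrr G u (suc i) = irrefl G i

addPendant : ∀ {n} → Graph n → Fin n → Graph (suc n)
addPendant G u = record { adj = pendAdj G u ; sym = pendSym G u ; irrefl = pendIrr G u }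

module Submission where

-- Upper bound: a γ_R^p-function of T extended by f(v) = 1 is a PRDF of T′.
-- Lower bound: let g be any PRDF of T′ and h its restriction to T, so that
-- w(g) = g(v) + w(h).  We distinguish the label of v.
--   * g(v) = 0: the unique 2-neighbour of v is u, so h is a PRDF of T with
--     h(u) = 2; since u ∈ W, h is not a γ_R^p-function, hence w(h) ≥ γ + 1.
--   * g(v) = 1, or g(v) = 2 with g(u) ≠ 0: h is a PRDF of T, so w(h) ≥ γ.
--   * g(v) = 2 and g(u) = 0: raising h(u) to 1 gives a PRDF of T, so
--     w(h) + 1 ≥ γ and w(g) = 2 + w(h) ≥ γ + 1.
-- The file first develops weight arithmetic, then two facts about arbitrary
-- graphs (PRDFs avoiding a W-vertex are heavy; a label 0 may be raised to 1),
-- then restriction/extension along the pendant edge, and finally the theorem.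

open import Defs hiding (sym)
open import Function using (_∘_)
open import Data.Nat using (ℕ; suc; _+_; _≤_; _<_; s≤s)
open import Data.Nat.Properties using (+-comm; ≤∧≢⇒<; m≤n⇒m≤1+n; +-commutativeSemigroup)
open import Data.Fin using (Fin; zero; suc; _≟_)
open import Data.Fin.Properties using (suc-injective)
open import Data.List using (tabulate)
open import Data.List.Properties using (map-tabulate)
open import Data.Nat.ListAction using (sum)
open import Data.Vec.Functional using (_∷_; updateAt)
open import Data.Vec.Functional.Properties using (updateAt-updates; updateAt-minimal)
open import Data.Product using (Σ; _×_; _,_)
open import Data.Empty using (⊥; ⊥-elim)
open import Relation.Nullary using (yes; no)
open import Relation.Binary.PropositionalEquality
  using (_≡_; _≢_; refl; sym; trans; cong; subst; module ≡-Reasoning)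
open import Algebra.Properties.CommutativeSemigroup +-commutativeSemigroup using (x∙yz≈y∙xz)

one : Label
one = suc zero

labels-differ : ∀ {x l l′ : Label} → x ≡ l → x ≡ l′ → l ≢ l′ → ⊥
labels-differ x≡l x≡l′ l≢l′ = l≢l′ (trans (sym x≡l) x≡l′)

PerfectlyDominated : ∀ {n} → Graph n → (Fin n → Label) → Fin n → Set
PerfectlyDominated {n} G f x = Σ (Fin n) λ v → (Adj G x v × f v ≡ two) ×
  (∀ (w : Fin n) → Adj G x w → f w ≡ two → w ≡ v)

weight-suc : ∀ {m} (f : Fin (suc m) → Label) → weight f ≡ val (f zero) + weight (f ∘ suc)
weight-suc f = begin
  weight f                                       ≡⟨ as-tabulate f ⟩
  val (f zero) + sum (tabulate (val ∘ f ∘ suc))  ≡⟨ cong (val (f zero) +_) (sym (as-tabulate (f ∘ suc))) ⟩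
  val (f zero) + weight (f ∘ suc)                ∎
  where
  open ≡-Reasoning
  as-tabulate : ∀ {m} (f : Fin m → Label) → weight f ≡ sum (tabulate (val ∘ f))
  as-tabulate f = cong sum (map-tabulate (λ x → x) (val ∘ f))

weight-raise : ∀ {m} (f : Fin m → Label) (u : Fin m) (l : Label) → f u ≡ zero →
  weight (updateAt f u (λ _ → l)) ≡ val l + weight f
weight-raise f zero l f0≡0 = begin
  weight (updateAt f zero (λ _ → l))        ≡⟨ weight-suc (updateAt f zero (λ _ → l)) ⟩
  val l + weight (f ∘ suc)                  ≡⟨ cong (λ a → val l + (val a + weight (f ∘ suc))) (sym f0≡0) ⟩
  val l + (val (f zero) + weight (f ∘ suc)) ≡⟨ cong (val l +_) (sym (weight-suc f)) ⟩
  val l + weight f                          ∎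
  where open ≡-Reasoning
weight-raise f (suc u) l fu≡0 = begin
  weight (updateAt f (suc u) (λ _ → l))            ≡⟨ weight-suc (updateAt f (suc u) (λ _ → l)) ⟩
  val (f zero) + weight (updateAt (f ∘ suc) u (λ _ → l))
    ≡⟨ cong (val (f zero) +_) (weight-raise (f ∘ suc) u l fu≡0) ⟩
  val (f zero) + (val l + weight (f ∘ suc))        ≡⟨ x∙yz≈y∙xz (val (f zero)) (val l) _ ⟩
  val l + (val (f zero) + weight (f ∘ suc))        ≡⟨ cong (val l +_) (sym (weight-suc f)) ⟩
  val l + weight f                                 ∎
  where open ≡-Reasoning

-- A PRDF of minimum weight is a γ_R^p-function and so vanishes on W(G);
-- hence a PRDF that does not vanish at a vertex of W(G) is strictly heavier.
heavier-off-W : ∀ {n} {G : Graph n} {k : ℕ} {u : Fin n} → IsGammaRP G k → InW G u →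
  ∀ (h : Fin n → Label) → IsPRDF G h → h u ≢ zero → k < weight h
heavier-off-W (_ , minimal) u∈W h h-prdf hu≢0 =
  ≤∧≢⇒< (minimal h h-prdf) λ k≡wh →
    hu≢0 (u∈W h (h-prdf , λ g g-prdf → subst (_≤ weight g) k≡wh (minimal g g-prdf)))

-- Raising a vertex u from label 0 to label 1 yields a PRDF, provided every
-- other vertex of label 0 was perfectly dominated: u was not labelled 2, so
-- no 2-neighbourhood changes.
raise-to-one : ∀ {n} (G : Graph n) (f : Fin n → Label) (u : Fin n) → f u ≡ zero →
  (∀ x → x ≢ u → f x ≡ zero → PerfectlyDominated G f x) →
  IsPRDF G (updateAt f u (λ _ → one))
raise-to-one G f u fu≡0 dominated x f′x≡0 with x ≟ u
... | yes refl = ⊥-elim (labels-differ (updateAt-updates u f) f′x≡0 λ ())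
... | no x≢u with dominated x x≢u (trans (sym (updateAt-minimal x u f x≢u)) f′x≡0)
...   | v , (x~v , fv≡2) , unique =
  v , (x~v , trans (updateAt-minimal v u f v≢u) fv≡2) , λ w x~w f′w≡2 → unique w x~w (keeps-two f′w≡2)
  where
  v≢u : v ≢ u
  v≢u refl = labels-differ fu≡0 fv≡2 λ ()
  keeps-two : ∀ {w} → updateAt f u (λ _ → one) w ≡ two → f w ≡ two
  keeps-two {w} f′w≡2 with w ≟ u
  ... | yes refl = ⊥-elim (labels-differ (updateAt-updates u f) f′w≡2 λ ())
  ... | no w≢u = trans (sym (updateAt-minimal w u f w≢u)) f′w≡2

-- Labellings of addPendant T u along the pendant edge u–v, where v = zero
-- and the old vertex i is suc i.
module Pendant {n} (T : Graph n) (u : Fin n) where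

  T′ : Graph (suc n)
  T′ = addPendant T u

  pendant-edge : ∀ {j} → Adj T′ (suc j) zero → j ≡ u
  pendant-edge {j} adj with j ≟ u
  ... | yes j≡u = j≡u
  pendant-edge () | no _

  -- Restricting to T keeps an old vertex perfectly dominated unless its
  -- 2-neighbour was v, which can only happen for u when g(v) = 2.
  restrict-dominated : ∀ (g : Fin (suc n) → Label) (i : Fin n) →
    PerfectlyDominated T′ g (suc i) → (i ≡ u → g zero ≢ two) →
    PerfectlyDominated T (g ∘ suc) i
  restrict-dominated g i (zero , (i~v , g0≡2) , _) not-via-v = ⊥-elim (not-via-v (pendant-edge i~v) g0≡2)
  restrict-dominated g i (suc j , (i~j , gj≡2) , unique) _ =
    j , (i~j , gj≡2) , λ w i~w gw≡2 → suc-injective (unique (suc w) i~w gw≡2)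

  restrict-away : ∀ (g : Fin (suc n) → Label) → IsPRDF T′ g →
    ∀ i → i ≢ u → g (suc i) ≡ zero → PerfectlyDominated T (g ∘ suc) i
  restrict-away g g-prdf i i≢u gi≡0 = restrict-dominated g i (g-prdf (suc i) gi≡0) λ i≡u _ → i≢u i≡u

  restrict : ∀ (g : Fin (suc n) → Label) → IsPRDF T′ g →
    (g zero ≡ two → g (suc u) ≢ zero) → IsPRDF T (g ∘ suc)
  restrict g g-prdf safe i gi≡0 = restrict-dominated g i (g-prdf (suc i) gi≡0) via-v-impossible
    where
    via-v-impossible : i ≡ u → g zero ≢ two
    via-v-impossible refl g0≡2 = safe g0≡2 gi≡0

  extend : ∀ (f : Fin n → Label) → IsPRDF T f → IsPRDF T′ (one ∷ f)
  extend f f-prdf zero ()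
  extend f f-prdf (suc i) fi≡0 with f-prdf i fi≡0
  ... | v , (i~v , fv≡2) , unique = suc v , (i~v , fv≡2) , unique′
    where
    unique′ : ∀ w → Adj T′ (suc i) w → (one ∷ f) w ≡ two → w ≡ suc v
    unique′ zero _ ()
    unique′ (suc w) i~w fw≡2 = cong suc (unique w i~w fw≡2)

  lower-bound : ∀ {k} → IsGammaRP T k → InW T u →
    ∀ (g : Fin (suc n) → Label) → IsPRDF T′ g → suc k ≤ weight g
  lower-bound {k} γ@(_ , minimal) u∈W g g-prdf =
    subst (suc k ≤_) (sym (weight-suc g)) (by-label (g zero) refl)
    where
    h : Fin n → Label
    h = g ∘ suc
    by-label : ∀ l → g zero ≡ l → suc k ≤ val l + weight h
    by-label zero g0≡0 with g-prdf zero g0≡0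
    ... | zero , (() , _) , _
    ... | suc j , (v~j , gj≡2) , _ with pendant-edge v~j
    ...   | refl = heavier-off-W {G = T} γ u∈W h
                     (restrict g g-prdf λ g0≡2 → ⊥-elim (labels-differ g0≡0 g0≡2 λ ()))
                     λ hu≡0 → labels-differ gj≡2 hu≡0 λ ()
    by-label (suc zero) g0≡1 =
      s≤s (minimal h (restrict g g-prdf λ g0≡2 → ⊥-elim (labels-differ g0≡1 g0≡2 λ ())))
    by-label (suc (suc zero)) _ with g (suc u) ≟ zero
    ... | no gu≢0 = m≤n⇒m≤1+n (s≤s (minimal h (restrict g g-prdf λ _ → gu≢0)))
    ... | yes gu≡0 = s≤s (subst (k ≤_) (weight-raise h u one gu≡0)
                       (minimal _ (raise-to-one T h u gu≡0 (restrict-away g g-prdf))))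

lemma2 : ∀ {n : ℕ} (T : Graph (suc n)) (u : Fin (suc n)) →
    IsTree T → PRDStable T → InW T u →
    ∀ (k : ℕ) → IsGammaRP T k → IsGammaRP (addPendant T u) (k + 1)
lemma2 T u _ _ u∈W k γ@((f , f-prdf , wf≡k) , _) =
  (one ∷ f , extend f f-prdf , weight-extended) ,
  λ g g-prdf → subst (_≤ weight g) (+-comm 1 k) (lower-bound γ u∈W g g-prdf)
  where
  open Pendant T u
  weight-extended : weight (one ∷ f) ≡ k + 1
  weight-extended = trans (weight-suc (one ∷ f)) (trans (cong suc wf≡k) (+-comm 1 k))
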